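{- Work in $\mathbf{CZF}$ and assume finitary NID. Then every flat, set-presented formal space has a set of points.
   Context: A formal space consists of a set $\mathbb P$ with a preorder $\le$ and a class relation $\triangleleft$ between elements and subsets of $\mathbb P$ such that: $a\in U$ implies $a\triangleleft U$; if $a\triangleleft U$ and $u\triangleleft V$ for all $u\in U$ then $a\triangleleft V$; if $a\le b\triangleleft U$ then $a\triangleleft U$; if $a\triangleleft U$ and $a\triangleleft V$ then $a\triangleleft{\downarrow}U\cap{\downarrow}V$ (${\downarrow}U=\{c:\exists u\in U\,c\le u\}$). It is set-presented if there is a function $\mathrm{BCov}$ assigning to each $a$ a set $\mathrm{BCov}(a)$ of subsets of $\mathbb P$ such that $a\triangleleft U$ iff $S\subseteq U$ for some $S\in\mathrm{BCov}(a)$. A point is an inhabited, upwards closed, downwards directed $\alpha\subseteq\mathbb P$ such that $a\in\alpha$ and $a\triangleleft S$ imply $S\cap\alpha$ inhabited. The space is flat if every point is minimal with respect to inclusion among points. Finitary NID: for every set $X$ and set $\mathcal R$ of finitary rules on $X$ (pairs $(a,b)$ of subsets of $X$ with $a$ the image of some $\{1,\dots,n\}$), the class of $Y\subseteq X$ closed under all rules ($a\subseteq Y$ implies $b\cap Y$ inhabited) is set-generated, i.e. there is a set $G$ of such $Y$ with: for every closed $Y$ and $x\in Y$ some $\beta\in G$ has $x\in\beta\subseteq Y$. -}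

module Defs where

open import Level using (Level; _⊔_; suc)
open import Data.Nat using (ℕ)
open import Data.Fin using (Fin)
open import Data.Product using (Σ; _×_; _,_)

Subset : ∀ {ℓ} → Set ℓ → Set (suc ℓ)
Subset {ℓ} A = A → Set ℓ

_⊆_ : ∀ {ℓ} {A : Set ℓ} → Subset A → Subset A → Set ℓ
U ⊆ V = ∀ x → U x → V x

_≐_ : ∀ {ℓ} {A : Set ℓ} → Subset A → Subset A → Set ℓ
U ≐ V = (U ⊆ V) × (V ⊆ U)

Inhabited : ∀ {ℓ} {A : Set ℓ} → Subset A → Set ℓ
Inhabited {A = A} U = Σ A U

↓∩↓ : ∀ {ℓ} {P : Set ℓ} → (P → P → Set ℓ) → Subset P → Subset P → Subset P
↓∩↓ {P = P} _≤_ U V c = (Σ P λ u → U u × c ≤ u) × (Σ P λ v → V v × c ≤ v)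

record FormalSpace (ℓ ℓc : Level) : Set (suc (ℓ ⊔ ℓc)) where
  field
    ℙ   : Set ℓ
    _≤_ : ℙ → ℙ → Set ℓ
    _◁_ : ℙ → Subset ℙ → Set ℓc
    ≤-refl  : ∀ a → a ≤ a
    ≤-trans : ∀ {a b c} → a ≤ b → b ≤ c → a ≤ c
    ◁-refl  : ∀ {a} {U : Subset ℙ} → U a → a ◁ U
    ◁-trans : ∀ {a} {U V : Subset ℙ} → a ◁ U → (∀ u → U u → u ◁ V) → a ◁ V
    ◁-≤     : ∀ {a b} {U : Subset ℙ} → a ≤ b → b ◁ U → a ◁ U
    ◁-∩     : ∀ {a} {U V : Subset ℙ} → a ◁ U → a ◁ V → a ◁ ↓∩↓ _≤_ U V

module _ {ℓ ℓc} (F : FormalSpace ℓ ℓc) where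
  open FormalSpace F

  -- Set-presentation: BCov(a) is a set of subsets, given as a family
  -- indexed by a set I a.
  SetPresented : Set (suc ℓ ⊔ ℓc)
  SetPresented =
    Σ (ℙ → Set ℓ) λ I →
    Σ ((a : ℙ) → I a → Subset ℙ) λ BCov →
      ∀ a (U : Subset ℙ) →
        ((a ◁ U → Σ (I a) λ i → BCov a i ⊆ U)
        × ((Σ (I a) λ i → BCov a i ⊆ U) → a ◁ U))

  record IsPoint (α : Subset ℙ) : Set (suc ℓ ⊔ ℓc) where
    field
      inhabited : Inhabited α
      up-closed : ∀ {a b} → α a → a ≤ b → α b
      directed  : ∀ {a b} → α a → α b → Σ ℙ λ c → α c × c ≤ a × c ≤ b
      splitting : ∀ {a} {S : Subset ℙ} → α a → a ◁ S → Inhabited (λ x → S x × α x)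

  Flat : Set (suc ℓ ⊔ ℓc)
  Flat = ∀ (α β : Subset ℙ) → IsPoint α → IsPoint β → β ⊆ α → α ⊆ β

  -- the class of points is a set: there is a set-indexed family of points
  -- such that every point is (extensionally) equal to a member of it.
  HasSetOfPoints : Set (suc ℓ ⊔ ℓc)
  HasSetOfPoints =
    Σ (Set ℓ) λ K →
    Σ (K → Subset ℙ) λ pt →
      (∀ k → IsPoint (pt k))
      × (∀ (α : Subset ℙ) → IsPoint α → Σ K λ k → pt k ≐ α)

-- A finitary rule on X: (a , b) with a the image of {1..n} (given by an
-- enumeration Fin n → X) and b a subset of X.
record FinRule {ℓ} (X : Set ℓ) : Set (suc ℓ) where
  field
    n    : ℕ
    prem : Fin n → X
    conc : Subset X

Closed : ∀ {ℓ} {X : Set ℓ} {J : Set ℓ} → (J → FinRule X) → Subset X → Set ℓ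
Closed R Y = ∀ j → (∀ i → Y (FinRule.prem (R j) i))
                 → Inhabited (λ x → FinRule.conc (R j) x × Y x)

FinitaryNID : (ℓ : Level) → Set (suc ℓ)
FinitaryNID ℓ =
  ∀ (X : Set ℓ) (J : Set ℓ) (R : J → FinRule X) →
    Σ (Set ℓ) λ K →
    Σ (K → Subset X) λ G →
      (∀ k → Closed R (G k))
      × (∀ (Y : Subset X) → Closed R Y → ∀ x → Y x →
           Σ K λ k → G k x × G k ⊆ Y)

-- Points of a set-presented formal space are exactly the subsets closed under
-- a set of finitary rules (inhabitedness, upward closure, directedness, and one
-- splitting rule per basic cover).  Finitary NID makes this class set-generated,
-- and flatness makes every generator below a point equal to it, so the
-- generators already enumerate all points.
module Submission where

open import Defs
open import Level using (Level)
open import Data.Fin using (zero; suc)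
open import Data.Product using (Σ; _×_; _,_; proj₁; proj₂)
open import Data.Unit.Polymorphic using (⊤; tt)
open import Relation.Binary.PropositionalEquality using (_≡_; refl; subst)

generated-minimal⇒enumerated :
  ∀ {ℓ ℓ′} {X : Set ℓ} (Member : Subset X → Set ℓ′) {K : Set ℓ} (G : K → Subset X) →
  (∀ k → Member (G k)) →
  (∀ Y → Member Y → ∀ x → Y x → Σ K λ k → G k x × G k ⊆ Y) →
  (∀ α β → Member α → Member β → β ⊆ α → α ⊆ β) →
  ∀ α → Member α → Inhabited α → Σ K λ k → G k ≐ α
generated-minimal⇒enumerated Member G G-member generates minimal α α-member (x , αx) =
  let (k , _ , Gk⊆α) = generates α α-member x αx
  in k , Gk⊆α , minimal α (G k) α-member (G-member k) Gk⊆α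

module PointRules {ℓ ℓc} (F : FormalSpace ℓ ℓc) (presentation : SetPresented F) where
  open FormalSpace F

  I : ℙ → Set ℓ
  I = proj₁ presentation

  BCov : (a : ℙ) → I a → Subset ℙ
  BCov = proj₁ (proj₂ presentation)

  ◁⇒BCov⊆ : ∀ {a U} → a ◁ U → Σ (I a) λ i → BCov a i ⊆ U
  ◁⇒BCov⊆ {a} {U} = proj₁ (proj₂ (proj₂ presentation) a U)

  ◁-BCov : ∀ a i → a ◁ BCov a i
  ◁-BCov a i = proj₂ (proj₂ (proj₂ presentation) a (BCov a i)) (i , λ _ b → b)

  data Rule : Set ℓ where
    inhabit : Rule
    upward  : (a b : ℙ) → a ≤ b → Rule
    meet    : (a b : ℙ) → Rule
    split   : (a : ℙ) → I a → Rule

  rule : Rule → FinRule ℙ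
  rule inhabit        = record { n = 0 ; prem = λ () ; conc = λ _ → ⊤ }
  rule (upward a b _) = record { n = 1 ; prem = λ _ → a ; conc = _≡ b }
  rule (meet a b)     = record { n = 2 ; prem = λ { zero → a ; (suc _) → b }
                               ; conc = λ c → c ≤ a × c ≤ b }
  rule (split a i)    = record { n = 1 ; prem = λ _ → a ; conc = BCov a i }

  closed⇒isPoint : ∀ Y → Closed rule Y → IsPoint F Y
  closed⇒isPoint Y closed = record
    { inhabited = let (x , _ , Yx) = closed inhabit (λ ()) in x , Yx
    ; up-closed = λ {a} {b} Ya a≤b →
        let (x , x≡b , Yx) = closed (upward a b a≤b) (λ _ → Ya) in subst Y x≡b Yx
    ; directed = λ {a} {b} Ya Yb →
        let (c , c≤a×c≤b , Yc) = closed (meet a b) (λ { zero → Ya ; (suc zero) → Yb })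
        in c , Yc , c≤a×c≤b
    ; splitting = λ {a} Ya a◁S →
        let (i , BCov⊆S) = ◁⇒BCov⊆ a◁S
            (x , BCov-x , Yx) = closed (split a i) (λ _ → Ya)
        in x , BCov⊆S x BCov-x , Yx
    }

  isPoint⇒closed : ∀ Y → IsPoint F Y → Closed rule Y
  isPoint⇒closed Y p inhabit _ = let (x , Yx) = inhabited in x , tt , Yx
    where open IsPoint p
  isPoint⇒closed Y p (upward a b a≤b) Yprem = b , refl , up-closed (Yprem zero) a≤b
    where open IsPoint p
  isPoint⇒closed Y p (meet a b) Yprem =
    let (c , Yc , c≤a×c≤b) = directed (Yprem zero) (Yprem (suc zero)) in c , c≤a×c≤b , Yc
    where open IsPoint p
  isPoint⇒closed Y p (split a i) Yprem = splitting (Yprem zero) (◁-BCov a i)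
    where open IsPoint p

corollary5p2 : (ℓ ℓc : Level) → FinitaryNID ℓ →
    (F : FormalSpace ℓ ℓc) → Flat F → SetPresented F → HasSetOfPoints F
corollary5p2 _ _ nid F flat presentation
  with nid (FormalSpace.ℙ F) (PointRules.Rule F presentation) (PointRules.rule F presentation)
... | K , G , G-closed , G-generates =
  K , G , G-point ,
  λ α α-point → generated-minimal⇒enumerated (IsPoint F) G G-point
                  (λ Y Y-point → G-generates Y (isPoint⇒closed Y Y-point))
                  flat α α-point (IsPoint.inhabited α-point)
  where
  open PointRules F presentation
  G-point : ∀ k → IsPoint F (G k)
  G-point k = closed⇒isPoint (G k) (G-closed k)
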